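{- Let $\Gamma$ be a subgroup of $\mathrm{PSL}_2(\mathbb{Z})$ of index at least $3$. Let $\rho=\frac12+\frac{\sqrt3}{2}i$. Then at least one of the stabilizers $\{\gamma\in\Gamma:\gamma\rho=\rho\}$ and $\{\gamma\in\Gamma:\gamma(\rho-1)=\rho-1\}$ is trivial; that is, at least one of the points $\rho$, $\rho-1=-\frac12+\frac{\sqrt3}{2}i$ is not an elliptic point of $\Gamma$.
   Context: $\mathrm{PSL}_2(\mathbb{Z})=\mathrm{SL}_2(\mathbb{Z})/\{\pm I\}$ acts on the upper half plane $\mathbb{H}$ by $z\mapsto\frac{az+b}{cz+d}$. A point of $\mathbb{H}$ is an elliptic point of $\Gamma$ if its stabilizer in $\Gamma$ is nontrivial. -}

module Defs where

open import Data.Integer using (ℤ; +_; -[1+_]; _+_; _*_; -_; _-_)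
open import Data.Product using (Σ; _×_; ∃-syntax)
open import Data.Sum using (_⊎_)
open import Relation.Binary.PropositionalEquality using (_≡_; _≢_)
open import Relation.Nullary using (¬_)

record Mat : Set where
  constructor mat
  field
    a b c d : ℤ

open Mat public

det : Mat → ℤ
det m = a m * d m - b m * c m

infixl 7 _⊙_
_⊙_ : Mat → Mat → Mat
m ⊙ n = mat (a m * a n + b m * c n) (a m * b n + b m * d n)
            (c m * a n + d m * c n) (c m * b n + d m * d n)

-- adjugate; the inverse of a matrix of determinant 1
adj : Mat → Mat
adj m = mat (d m) (- b m) (- c m) (a m)

I : Mat
I = mat (+ 1) (+ 0) (+ 0) (+ 1)

-I : Mat
-I = mat (- + 1) (+ 0) (+ 0) (- + 1)

-- Subgroups of PSL₂(ℤ) = SL₂(ℤ)/{±I}, represented (as usual) by their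
-- preimages in SL₂(ℤ): subgroups of SL₂(ℤ) containing -I.

record Subgroup : Set₁ where
  field
    member     : Mat → Set
    ⊆SL₂       : ∀ {g} → member g → det g ≡ + 1
    one        : member I
    mul-closed : ∀ {g h} → member g → member h → member (g ⊙ h)
    inv-closed : ∀ {g} → member g → member (adj g)
    has-I      : member -I

open Subgroup public

-- Index at least 3: there are three elements of PSL₂(ℤ) (represented in
-- SL₂(ℤ)) lying in pairwise distinct cosets of Γ.
SameCoset : Subgroup → Mat → Mat → Set
SameCoset Γ g h = member Γ (adj g ⊙ h)

IndexAtLeast3 : Subgroup → Set
IndexAtLeast3 Γ =
  ∃[ g₁ ] ∃[ g₂ ] ∃[ g₃ ]
    (det g₁ ≡ + 1) × (det g₂ ≡ + 1) × (det g₃ ≡ + 1) ×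
    ¬ SameCoset Γ g₁ g₂ × ¬ SameCoset Γ g₁ g₃ × ¬ SameCoset Γ g₂ g₃

-- ℤ[ρ] ⊂ ℂ, ρ = 1/2 + (√3/2) i, so ρ² = ρ - 1.  Element ⟨ x , y ⟩ρ means x + y ρ.

record ℤρ : Set where
  constructor ⟨_,_⟩ρ
  field
    re im : ℤ

open ℤρ public

infixl 6 _⊕_
_⊕_ : ℤρ → ℤρ → ℤρ
⟨ x , y ⟩ρ ⊕ ⟨ x' , y' ⟩ρ = ⟨ x + x' , y + y' ⟩ρ

infixl 7 _⊗_
_⊗_ : ℤρ → ℤρ → ℤρ
⟨ x , y ⟩ρ ⊗ ⟨ x' , y' ⟩ρ =
  ⟨ x * x' - y * y' , x * y' + y * x' + y * y' ⟩ρ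

embed : ℤ → ℤρ
embed n = ⟨ n , + 0 ⟩ρ

ρ : ℤρ
ρ = ⟨ + 0 , + 1 ⟩ρ

ρ-1 : ℤρ
ρ-1 = ⟨ - + 1 , + 1 ⟩ρ

-- γ z = z, for γ = (a b ; c d) ∈ SL₂(ℤ) and z ∈ ℍ, i.e.
-- (a z + b)/(c z + d) = z; since c z + d ≠ 0 for z ∈ ℍ this is
-- a z + b = z (c z + d).
Fixes : Mat → ℤρ → Set
Fixes γ z = embed (a γ) ⊗ z ⊕ embed (b γ) ≡ z ⊗ (embed (c γ) ⊗ z ⊕ embed (d γ))

-- The stabilizer {γ ∈ Γ : γ z = z} in PSL₂(ℤ) is nontrivial:
-- it contains some γ ≠ ±I.
NontrivialStab : Subgroup → ℤρ → Set
NontrivialStab Γ z = ∃[ γ ] member Γ γ × Fixes γ z × γ ≢ I × γ ≢ -I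

{-# OPTIONS --safe #-}
module Submission where

-- If both stabilisers are nontrivial then Γ contains A = (1 -1 ; 1 0), which generates
-- the stabiliser of ρ, and B = (0 -1 ; 1 1), which generates that of ρ - 1 (the only
-- solutions of c² ± cd + d² = 1 have |c|, |d| ≤ 1).  Since S T = B, T S⁻¹ = -A,
-- S T⁻¹ = A² and T⁻¹ S⁻¹ = B⁻¹, the set Γ ∪ S⁻¹Γ is stable under left multiplication by
-- S^±1 and T^±1.  These generate SL₂(ℤ) (Euclid's algorithm on the first column), so
-- Γ ∪ S⁻¹Γ is everything and Γ has index at most 2.

open import Defs
open import Data.Empty using (⊥-elim)
open import Data.Integer hiding (suc)
open import Data.Integer.DivMod using (a≡a%n+[a/n]*n; n%d<d)
open import Data.Integer.Properties using (+◃n≡+n; pos-*; pos-+; +-injective; abs-*; +-inverseʳ; *-zeroʳ)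
open import Data.Integer.Tactic.RingSolver using (solve)
open import Data.List using ([]; _∷_)
open import Data.Nat as ℕ using (ℕ; zero; suc; s≤s)
import Data.Nat.Properties as ℕ
open import Data.Product using (_×_; _,_)
open import Data.Sum using (_⊎_; inj₁; inj₂)
open import Relation.Binary.PropositionalEquality
open import Relation.Nullary using (¬_)

mat-cong : ∀ {a₁ b₁ c₁ d₁ a₂ b₂ c₂ d₂} → a₁ ≡ a₂ → b₁ ≡ b₂ → c₁ ≡ c₂ → d₁ ≡ d₂ →
           mat a₁ b₁ c₁ d₁ ≡ mat a₂ b₂ c₂ d₂
mat-cong refl refl refl refl = refl

⊙-assoc : ∀ x y z → (x ⊙ y) ⊙ z ≡ x ⊙ (y ⊙ z)
⊙-assoc (mat a b c d) (mat e f g h) (mat i j k l) =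
  mat-cong (entry a b i k) (entry a b j l) (entry c d i k) (entry c d j l)
  where
  entry : ∀ x y z w →
          (x * e + y * g) * z + (x * f + y * h) * w ≡ x * (e * z + f * w) + y * (g * z + h * w)
  entry x y z w = solve (x ∷ y ∷ z ∷ w ∷ e ∷ f ∷ g ∷ h ∷ [])

⊙-identityˡ : ∀ x → I ⊙ x ≡ x
⊙-identityˡ (mat a b c d) = mat-cong (top a c) (top b d) (bottom a c) (bottom b d)
  where
  top : ∀ x y → + 1 * x + + 0 * y ≡ x
  top x y = solve (x ∷ y ∷ [])
  bottom : ∀ x y → + 0 * x + + 1 * y ≡ y
  bottom x y = solve (x ∷ y ∷ [])

⊙-identityʳ : ∀ x → x ⊙ I ≡ x
⊙-identityʳ (mat a b c d) = mat-cong (left a b) (right a b) (left c d) (right c d)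
  where
  left : ∀ x y → x * + 1 + y * + 0 ≡ x
  left x y = solve (x ∷ y ∷ [])
  right : ∀ x y → x * + 0 + y * + 1 ≡ y
  right x y = solve (x ∷ y ∷ [])

adj-⊙ : ∀ x y → adj (x ⊙ y) ≡ adj y ⊙ adj x
adj-⊙ (mat a b c d) (mat e f g h) = mat-cong entry-a entry-b entry-c entry-d
  where
  entry-a : c * f + d * h ≡ h * d + (- f) * (- c)
  entry-a = solve (c ∷ d ∷ f ∷ h ∷ [])
  entry-b : - (a * f + b * h) ≡ h * (- b) + (- f) * a
  entry-b = solve (a ∷ b ∷ f ∷ h ∷ [])
  entry-c : - (c * e + d * g) ≡ (- g) * d + e * (- c)
  entry-c = solve (c ∷ d ∷ e ∷ g ∷ [])
  entry-d : a * e + b * g ≡ (- g) * (- b) + e * a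
  entry-d = solve (a ∷ b ∷ e ∷ g ∷ [])

det-⊙ : ∀ x y → det (x ⊙ y) ≡ det x * det y
det-⊙ (mat a b c d) (mat e f g h) = cauchy-binet
  where
  cauchy-binet : (a * e + b * g) * (c * f + d * h) - (a * f + b * h) * (c * e + d * g)
               ≡ (a * d - b * c) * (e * h - f * g)
  cauchy-binet = solve (a ∷ b ∷ c ∷ d ∷ e ∷ f ∷ g ∷ h ∷ [])

det-⊙≡1 : ∀ x y → det x ≡ + 1 → det y ≡ + 1 → det (x ⊙ y) ≡ + 1
det-⊙≡1 x y det-x det-y = trans (det-⊙ x y) (cong₂ _*_ det-x det-y)

⊙-cancelˡ : ∀ X Y g → X ⊙ Y ≡ I → X ⊙ (Y ⊙ g) ≡ g
⊙-cancelˡ X Y g XY≡I = begin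
  X ⊙ (Y ⊙ g) ≡⟨ ⊙-assoc X Y g ⟨
  (X ⊙ Y) ⊙ g ≡⟨ cong (_⊙ g) XY≡I ⟩
  I ⊙ g       ≡⟨ ⊙-identityˡ g ⟩
  g           ∎
  where open ≡-Reasoning

⊙-cancel-middle : ∀ W X Y g → X ⊙ Y ≡ I → (W ⊙ X) ⊙ (Y ⊙ g) ≡ W ⊙ g
⊙-cancel-middle W X Y g XY≡I = trans (⊙-assoc W X (Y ⊙ g)) (cong (W ⊙_) (⊙-cancelˡ X Y g XY≡I))

S T A B : Mat
S = mat (+ 0) (- + 1) (+ 1) (+ 0)
T = mat (+ 1) (+ 1) (+ 0) (+ 1)
A = mat (+ 1) (- + 1) (+ 1) (+ 0)
B = mat (+ 0) (- + 1) (+ 1) (+ 1)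

T^_ : ℤ → Mat
T^ k = mat (+ 1) k (+ 0) (+ 1)

T^-+ : ∀ k l → T^ k ⊙ T^ l ≡ T^ (k + l)
T^-+ k l = mat-cong corner shift refl refl
  where
  corner : + 1 * + 1 + k * + 0 ≡ + 1
  corner = cong (_+_ (+ 1)) (*-zeroʳ k)
  shift : + 1 * l + k * + 1 ≡ k + l
  shift = solve (k ∷ l ∷ [])

T^-⊙-T^-⊙ : ∀ k l g → T^ k ⊙ (T^ l ⊙ g) ≡ T^ (k + l) ⊙ g
T^-⊙-T^-⊙ k l g = trans (sym (⊙-assoc (T^ k) (T^ l) g)) (cong (_⊙ g) (T^-+ k l))

det-T^ : ∀ k → det (T^ k) ≡ + 1
det-T^ k = cong (_-_ (+ 1)) (*-zeroʳ k)

T^-inverseʳ : ∀ k g → T^ k ⊙ (T^ (- k) ⊙ g) ≡ g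
T^-inverseʳ k g = ⊙-cancelˡ (T^ k) (T^ (- k)) g (trans (T^-+ k (- k)) (cong T^_ (+-inverseʳ k)))

c-S⊙T^⊙ : ∀ k g → Mat.c (S ⊙ (T^ k ⊙ g)) ≡ Mat.a g + k * Mat.c g
c-S⊙T^⊙ k (mat a b c d) = entry
  where
  entry : + 1 * (+ 1 * a + k * c) + + 0 * (+ 0 * a + + 1 * c) ≡ a + k * c
  entry = solve (k ∷ a ∷ c ∷ [])

∣i∣≡1⇒i≡±1 : ∀ i → ∣ i ∣ ≡ 1 → i ≡ + 1 ⊎ i ≡ - + 1
∣i∣≡1⇒i≡±1 (+ 1)          _ = inj₁ refl
∣i∣≡1⇒i≡±1 -[1+ 0 ]       _ = inj₂ refl
∣i∣≡1⇒i≡±1 (+ 0)          ()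
∣i∣≡1⇒i≡±1 +[1+ suc n ]   ()
∣i∣≡1⇒i≡±1 -[1+ suc n ]   ()

module SL₂-Induction
  (P : Mat → Set)
  (P-I : P I)
  (P-T : ∀ g → P g → P (T ⊙ g))
  (P-T⁻¹ : ∀ g → P g → P (adj T ⊙ g))
  (P-S : ∀ g → P g → P (S ⊙ g))
  (P-S⁻¹ : ∀ g → P g → P (adj S ⊙ g))
  where

  P-T^ : ∀ k g → P g → P (T^ k ⊙ g)
  P-T^ (+ zero)      g Pg = subst P (sym (⊙-identityˡ g)) Pg
  P-T^ (+[1+ n ])    g Pg = subst P (T^-⊙-T^-⊙ (+ 1) (+ n) g) (P-T _ (P-T^ (+ n) g Pg))
  P-T^ -[1+ zero ]   g Pg = P-T⁻¹ g Pg
  P-T^ -[1+ suc n ]  g Pg = subst P (T^-⊙-T^-⊙ -[1+ 0 ] -[1+ n ] g) (P-T⁻¹ _ (P-T^ -[1+ n ] g Pg))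

  P-T^⁻ : ∀ k g → P (T^ (- k) ⊙ g) → P g
  P-T^⁻ k g Pg = subst P (T^-inverseʳ k g) (P-T^ k _ Pg)

  P-S⁻ : ∀ g → P (S ⊙ g) → P g
  P-S⁻ g PSg = subst P (⊙-cancelˡ (adj S) S g refl) (P-S⁻¹ _ PSg)

  P-upper-triangular : ∀ a b d → a * d ≡ + 1 → P (mat a b (+ 0) d)
  P-upper-triangular a b d ad≡1 with ∣i∣≡1⇒i≡±1 a ∣a∣≡1 | ∣i∣≡1⇒i≡±1 d ∣d∣≡1
    where
    ∣a∣∣d∣≡1 : ∣ a ∣ ℕ.* ∣ d ∣ ≡ 1
    ∣a∣∣d∣≡1 = trans (sym (abs-* a d)) (cong ∣_∣ ad≡1)
    ∣a∣≡1 : ∣ a ∣ ≡ 1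
    ∣a∣≡1 = ℕ.m*n≡1⇒m≡1 ∣ a ∣ ∣ d ∣ ∣a∣∣d∣≡1
    ∣d∣≡1 : ∣ d ∣ ≡ 1
    ∣d∣≡1 = ℕ.m*n≡1⇒n≡1 ∣ a ∣ ∣ d ∣ ∣a∣∣d∣≡1
  ... | inj₁ refl | inj₁ refl = subst P (⊙-identityʳ (T^ b)) (P-T^ b I P-I)
  P-upper-triangular _ b _ () | inj₁ refl | inj₂ refl
  P-upper-triangular _ b _ () | inj₂ refl | inj₁ refl
  ... | inj₂ refl | inj₂ refl = subst P T^-b⊙-I≡ (P-T^ (- b) -I (P-S _ (P-S I P-I)))
    where
    T^-b⊙-I≡ : T^ (- b) ⊙ -I ≡ mat (- + 1) b (+ 0) (- + 1)
    T^-b⊙-I≡ = mat-cong (cong (_+_ (- + 1)) (*-zeroʳ (- b))) entry-b refl refl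
      where
      entry-b : + 1 * + 0 + (- b) * (- + 1) ≡ b
      entry-b = solve (b ∷ [])

  P-euclid-step : ∀ n g .{{_ : NonZero (Mat.c g)}} → ∣ Mat.c g ∣ ℕ.< suc n → det g ≡ + 1 →
                  (∀ h → ∣ Mat.c h ∣ ℕ.< n → det h ≡ + 1 → P h) → P g
  P-euclid-step n g@(mat a b c d) ∣c∣<1+n det-g IH = P-T^⁻ q g (P-S⁻ _ (IH h ∣c-h∣<n det-h))
    where
    q : ℤ
    q = a / c
    h : Mat
    h = S ⊙ (T^ (- q) ⊙ g)
    remove-multiple : ∀ {x} r k → x ≡ r + k * c → x + - k * c ≡ r
    remove-multiple r k refl = solve (r ∷ k ∷ c ∷ [])
    c-h : Mat.c h ≡ + (a % c)
    c-h = trans (c-S⊙T^⊙ (- q) g) (remove-multiple (+ (a % c)) q (a≡a%n+[a/n]*n a c))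
    ∣c-h∣<n : ∣ Mat.c h ∣ ℕ.< n
    ∣c-h∣<n = subst (ℕ._< n) (sym (cong ∣_∣ c-h)) (ℕ.<-≤-trans (n%d<d a c) (ℕ.≤-pred ∣c∣<1+n))
    det-h : det h ≡ + 1
    det-h = det-⊙≡1 S (T^ (- q) ⊙ g) refl (det-⊙≡1 (T^ (- q)) g (det-T^ (- q)) det-g)

  P-bounded : ∀ n g → ∣ Mat.c g ∣ ℕ.< n → det g ≡ + 1 → P g
  P-bounded zero    _ ()
  P-bounded (suc n) (mat a b (+ 0) d) _ det-g = P-upper-triangular a b d (trans (sym det≡ad) det-g)
    where
    det≡ad : a * d - b * + 0 ≡ a * d
    det≡ad = solve (a ∷ b ∷ d ∷ [])
  P-bounded (suc n) g@(mat _ _ +[1+ _ ] _) ∣c∣<1+n det-g = P-euclid-step n g ∣c∣<1+n det-g (P-bounded n)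
  P-bounded (suc n) g@(mat _ _ -[1+ _ ] _) ∣c∣<1+n det-g = P-euclid-step n g ∣c∣<1+n det-g (P-bounded n)

  SL₂-induction : ∀ g → det g ≡ + 1 → P g
  SL₂-induction g = P-bounded (suc ∣ Mat.c g ∣) g (ℕ.n<1+n _)

module Γ∪R⁻¹Γ (Γ : Subgroup) (R : Mat) (R⁻¹R≡I : adj R ⊙ R ≡ I) where

  InΓ∪R⁻¹Γ : Mat → Set
  InΓ∪R⁻¹Γ g = member Γ g ⊎ member Γ (R ⊙ g)

  left-mul-closed : ∀ X → InΓ∪R⁻¹Γ X → InΓ∪R⁻¹Γ (X ⊙ adj R) →
                    ∀ g → InΓ∪R⁻¹Γ g → InΓ∪R⁻¹Γ (X ⊙ g)
  left-mul-closed X (inj₁ X∈Γ) _ g (inj₁ g∈Γ) = inj₁ (mul-closed Γ X∈Γ g∈Γ)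
  left-mul-closed X (inj₂ RX∈Γ) _ g (inj₁ g∈Γ) =
    inj₂ (subst (member Γ) (⊙-assoc R X g) (mul-closed Γ RX∈Γ g∈Γ))
  left-mul-closed X _ (inj₁ XR⁻¹∈Γ) g (inj₂ Rg∈Γ) =
    inj₁ (subst (member Γ) (⊙-cancel-middle X (adj R) R g R⁻¹R≡I) (mul-closed Γ XR⁻¹∈Γ Rg∈Γ))
  left-mul-closed X _ (inj₂ RXR⁻¹∈Γ) g (inj₂ Rg∈Γ) =
    inj₂ (subst (member Γ) RXR⁻¹⊙Rg≡RXg (mul-closed Γ RXR⁻¹∈Γ Rg∈Γ))
    where
    RXR⁻¹⊙Rg≡RXg : (R ⊙ (X ⊙ adj R)) ⊙ (R ⊙ g) ≡ R ⊙ (X ⊙ g)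
    RXR⁻¹⊙Rg≡RXg = trans (⊙-assoc R (X ⊙ adj R) (R ⊙ g))
                         (cong (R ⊙_) (⊙-cancel-middle X (adj R) R g R⁻¹R≡I))

  SameCoset-Γ : ∀ {g h} → member Γ g → member Γ h → SameCoset Γ g h
  SameCoset-Γ g∈Γ h∈Γ = mul-closed Γ (inv-closed Γ g∈Γ) h∈Γ

  SameCoset-R⁻¹Γ : ∀ {g h} → member Γ (R ⊙ g) → member Γ (R ⊙ h) → SameCoset Γ g h
  SameCoset-R⁻¹Γ {g} {h} Rg∈Γ Rh∈Γ = subst (member Γ) adj[Rg]⊙Rh≡adj[g]⊙h (SameCoset-Γ Rg∈Γ Rh∈Γ)
    where
    adj[Rg]⊙Rh≡adj[g]⊙h : adj (R ⊙ g) ⊙ (R ⊙ h) ≡ adj g ⊙ h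
    adj[Rg]⊙Rh≡adj[g]⊙h = trans (cong (_⊙ (R ⊙ h)) (adj-⊙ R g)) (⊙-cancel-middle (adj g) (adj R) R h R⁻¹R≡I)

  pigeonhole : ∀ {g₁ g₂ g₃} → InΓ∪R⁻¹Γ g₁ → InΓ∪R⁻¹Γ g₂ → InΓ∪R⁻¹Γ g₃ →
               SameCoset Γ g₁ g₂ ⊎ SameCoset Γ g₁ g₃ ⊎ SameCoset Γ g₂ g₃
  pigeonhole (inj₁ p) (inj₁ q) _        = inj₁ (SameCoset-Γ p q)
  pigeonhole (inj₂ p) (inj₂ q) _        = inj₁ (SameCoset-R⁻¹Γ p q)
  pigeonhole (inj₁ p) (inj₂ q) (inj₁ r) = inj₂ (inj₁ (SameCoset-Γ p r))
  pigeonhole (inj₁ p) (inj₂ q) (inj₂ r) = inj₂ (inj₂ (SameCoset-R⁻¹Γ q r))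
  pigeonhole (inj₂ p) (inj₁ q) (inj₁ r) = inj₂ (inj₂ (SameCoset-Γ q r))
  pigeonhole (inj₂ p) (inj₁ q) (inj₂ r) = inj₂ (inj₁ (SameCoset-R⁻¹Γ p r))

  covering⇒¬IndexAtLeast3 : (∀ g → det g ≡ + 1 → InΓ∪R⁻¹Γ g) → ¬ IndexAtLeast3 Γ
  covering⇒¬IndexAtLeast3 cover (g₁ , g₂ , g₃ , det₁ , det₂ , det₃ , ¬12 , ¬13 , ¬23)
    with pigeonhole (cover g₁ det₁) (cover g₂ det₂) (cover g₃ det₃)
  ... | inj₁ same12        = ¬12 same12
  ... | inj₂ (inj₁ same13) = ¬13 same13
  ... | inj₂ (inj₂ same23) = ¬23 same23

A,B∈Γ⇒covered-by-Γ∪S⁻¹Γ : ∀ Γ → member Γ A → member Γ B →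
                          ∀ g → det g ≡ + 1 → member Γ g ⊎ member Γ (S ⊙ g)
A,B∈Γ⇒covered-by-Γ∪S⁻¹Γ Γ A∈Γ B∈Γ =
  SL₂-Induction.SL₂-induction InΓ∪R⁻¹Γ (inj₁ (one Γ))
    (left-mul-closed T (inj₂ B∈Γ) (inj₁ (mul-closed Γ (has-I Γ) A∈Γ)))
    (left-mul-closed (adj T) (inj₂ (mul-closed Γ A∈Γ A∈Γ)) (inj₁ (inv-closed Γ B∈Γ)))
    (left-mul-closed S (inj₂ (has-I Γ)) (inj₁ (one Γ)))
    (left-mul-closed (adj S) (inj₂ (one Γ)) (inj₁ (has-I Γ)))
  where open Γ∪R⁻¹Γ Γ S refl

data UnitOrZero : ℤ → Set where
  is-0  : UnitOrZero (+ 0)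
  is-1  : UnitOrZero (+ 1)
  is-−1 : UnitOrZero (- + 1)

∣i∣≤1⇒UnitOrZero : ∀ i → ∣ i ∣ ℕ.≤ 1 → UnitOrZero i
∣i∣≤1⇒UnitOrZero (+ 0)        _ = is-0
∣i∣≤1⇒UnitOrZero (+ 1)        _ = is-1
∣i∣≤1⇒UnitOrZero -[1+ 0 ]     _ = is-−1
∣i∣≤1⇒UnitOrZero +[1+ suc n ] (s≤s ())
∣i∣≤1⇒UnitOrZero -[1+ suc n ] (s≤s ())

i*i≡+∣i∣*∣i∣ : ∀ i → i * i ≡ + (∣ i ∣ ℕ.* ∣ i ∣)
i*i≡+∣i∣*∣i∣ (+ m)     = +◃n≡+n (m ℕ.* m)
i*i≡+∣i∣*∣i∣ -[1+ m ]  = +◃n≡+n (suc m ℕ.* suc m)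

x²+3y²≡4⇒∣y∣≤1 : ∀ x y → x * x + + 3 * (y * y) ≡ + 4 → ∣ y ∣ ℕ.≤ 1
x²+3y²≡4⇒∣y∣≤1 x y eq = ℕ.≮⇒≥ λ 1<∣y∣ → ℕ.<⇒≱ 4<12 (begin
  12             ≤⟨ ℕ.*-monoʳ-≤ 3 (ℕ.*-mono-≤ 1<∣y∣ 1<∣y∣) ⟩
  3 ℕ.* Y        ≤⟨ ℕ.m≤n+m (3 ℕ.* Y) X ⟩
  X ℕ.+ 3 ℕ.* Y  ≡⟨ eq-in-ℕ ⟩
  4              ∎)
  where
  open ℕ.≤-Reasoning
  X Y : ℕ
  X = ∣ x ∣ ℕ.* ∣ x ∣
  Y = ∣ y ∣ ℕ.* ∣ y ∣
  4<12 : 4 ℕ.< 12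
  4<12 = ℕ.m≤m+n 5 7
  eq-in-ℕ : X ℕ.+ 3 ℕ.* Y ≡ 4
  eq-in-ℕ = +-injective (trans (pos-+ X (3 ℕ.* Y)) (trans (cong (_+_ (+ X)) (pos-* 3 Y))
              (trans (sym (cong₂ (λ u v → u + + 3 * v) (i*i≡+∣i∣*∣i∣ x) (i*i≡+∣i∣*∣i∣ y))) eq)))

x²+xy+y²≡1⇒UnitOrZero : ∀ x y → x * x + x * y + y * y ≡ + 1 → UnitOrZero y
x²+xy+y²≡1⇒UnitOrZero x y eq =
  ∣i∣≤1⇒UnitOrZero y (x²+3y²≡4⇒∣y∣≤1 (+ 2 * x + y) y (trans complete-square (cong (+ 4 *_) eq)))
  where
  complete-square : (+ 2 * x + y) * (+ 2 * x + y) + + 3 * (y * y) ≡ + 4 * (x * x + x * y + y * y)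
  complete-square = solve (x ∷ y ∷ [])

-- The middle terms of the chains below are the components of both sides of Fixes as
-- computed by _⊗_ and _⊕_.
fixes-ρ⇒ : ∀ a b c d → Fixes (mat a b c d) ρ → a ≡ c + d × b ≡ - c
fixes-ρ⇒ a b c d fix = a≡c+d , b≡-c
  where
  open ≡-Reasoning
  a≡c+d : a ≡ c + d
  a≡c+d = begin
    a                                                ≡⟨ solve (a ∷ []) ⟩
    a * + 1 + + 0 * + 0 + + 0 * + 1 + + 0            ≡⟨ cong im fix ⟩
    + 0 * (c * + 1 + + 0 * + 0 + + 0 * + 1 + + 0)
      + + 1 * (c * + 0 - + 0 * + 1 + d)
      + + 1 * (c * + 1 + + 0 * + 0 + + 0 * + 1 + + 0)  ≡⟨ solve (c ∷ d ∷ []) ⟩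
    c + d                                            ∎
  b≡-c : b ≡ - c
  b≡-c = begin
    b                                                ≡⟨ solve (a ∷ b ∷ []) ⟩
    a * + 0 - + 0 * + 1 + b                          ≡⟨ cong re fix ⟩
    + 0 * (c * + 0 - + 0 * + 1 + d)
      - + 1 * (c * + 1 + + 0 * + 0 + + 0 * + 1 + + 0)  ≡⟨ solve (c ∷ d ∷ []) ⟩
    - c                                              ∎

fixes-ρ-1⇒ : ∀ a b c d → Fixes (mat a b c d) ρ-1 → a ≡ d - c × b ≡ - c
fixes-ρ-1⇒ a b c d fix = a≡d-c , b≡-c
  where
  open ≡-Reasoning
  a≡d-c : a ≡ d - c
  a≡d-c = begin
    a                                                      ≡⟨ solve (a ∷ []) ⟩
    a * + 1 + + 0 * (- + 1) + + 0 * + 1 + + 0              ≡⟨ cong im fix ⟩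
    (- + 1) * (c * + 1 + + 0 * (- + 1) + + 0 * + 1 + + 0)
      + + 1 * (c * (- + 1) - + 0 * + 1 + d)
      + + 1 * (c * + 1 + + 0 * (- + 1) + + 0 * + 1 + + 0)    ≡⟨ solve (c ∷ d ∷ []) ⟩
    d - c                                                  ∎
  b≡-c : b ≡ - c
  b≡-c = begin
    b                                                      ≡⟨ solve (a ∷ b ∷ []) ⟩
    (a * (- + 1) - + 0 * + 1 + b) + a                      ≡⟨ cong₂ _+_ (cong re fix) a≡d-c ⟩
    ((- + 1) * (c * (- + 1) - + 0 * + 1 + d)
      - + 1 * (c * + 1 + + 0 * (- + 1) + + 0 * + 1 + + 0)) + (d - c)  ≡⟨ solve (c ∷ d ∷ []) ⟩
    - c                                                    ∎

module _ (Γ : Subgroup) where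

  -- Stab(ρ) = {±I, ±A, ±A⁻¹}; the other three pairs (c, d) give determinant 0 or 3.
  stab-ρ-element⇒A∈Γ : ∀ {c d} → UnitOrZero c → UnitOrZero d → let γ = mat (c + d) (- c) c d in
                       det γ ≡ + 1 → member Γ γ → γ ≢ I → γ ≢ -I → member Γ A
  stab-ρ-element⇒A∈Γ is-0  is-0  ()
  stab-ρ-element⇒A∈Γ is-0  is-1  _ _ γ≢I _    = ⊥-elim (γ≢I refl)
  stab-ρ-element⇒A∈Γ is-0  is-−1 _ _ _ γ≢-I   = ⊥-elim (γ≢-I refl)
  stab-ρ-element⇒A∈Γ is-1  is-0  _ γ∈Γ _ _    = γ∈Γ
  stab-ρ-element⇒A∈Γ is-1  is-1  ()
  stab-ρ-element⇒A∈Γ is-1  is-−1 _ γ∈Γ _ _    = mul-closed Γ (has-I Γ) (inv-closed Γ γ∈Γ)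
  stab-ρ-element⇒A∈Γ is-−1 is-0  _ γ∈Γ _ _    = mul-closed Γ (has-I Γ) γ∈Γ
  stab-ρ-element⇒A∈Γ is-−1 is-1  _ γ∈Γ _ _    = inv-closed Γ γ∈Γ
  stab-ρ-element⇒A∈Γ is-−1 is-−1 ()

  stab-ρ-1-element⇒B∈Γ : ∀ {c d} → UnitOrZero c → UnitOrZero d → let γ = mat (d - c) (- c) c d in
                         det γ ≡ + 1 → member Γ γ → γ ≢ I → γ ≢ -I → member Γ B
  stab-ρ-1-element⇒B∈Γ is-0  is-0  ()
  stab-ρ-1-element⇒B∈Γ is-0  is-1  _ _ γ≢I _    = ⊥-elim (γ≢I refl)
  stab-ρ-1-element⇒B∈Γ is-0  is-−1 _ _ _ γ≢-I   = ⊥-elim (γ≢-I refl)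
  stab-ρ-1-element⇒B∈Γ is-1  is-0  _ γ∈Γ _ _    = mul-closed Γ (has-I Γ) (inv-closed Γ γ∈Γ)
  stab-ρ-1-element⇒B∈Γ is-1  is-1  _ γ∈Γ _ _    = γ∈Γ
  stab-ρ-1-element⇒B∈Γ is-1  is-−1 ()
  stab-ρ-1-element⇒B∈Γ is-−1 is-0  _ γ∈Γ _ _    = inv-closed Γ γ∈Γ
  stab-ρ-1-element⇒B∈Γ is-−1 is-1  ()
  stab-ρ-1-element⇒B∈Γ is-−1 is-−1 _ γ∈Γ _ _    = mul-closed Γ (has-I Γ) γ∈Γ

  NontrivialStab-ρ⇒A∈Γ : NontrivialStab Γ ρ → member Γ A
  NontrivialStab-ρ⇒A∈Γ (mat a b c d , γ∈Γ , fix , γ≢I , γ≢-I) with fixes-ρ⇒ a b c d fix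
  ... | refl , refl = stab-ρ-element⇒A∈Γ
    (x²+xy+y²≡1⇒UnitOrZero d c (trans norm-via-d det≡1))
    (x²+xy+y²≡1⇒UnitOrZero c d (trans norm-via-c det≡1))
    det≡1 γ∈Γ γ≢I γ≢-I
    where
    det≡1 : (c + d) * d - (- c) * c ≡ + 1
    det≡1 = ⊆SL₂ Γ γ∈Γ
    norm-via-d : d * d + d * c + c * c ≡ (c + d) * d - (- c) * c
    norm-via-d = solve (c ∷ d ∷ [])
    norm-via-c : c * c + c * d + d * d ≡ (c + d) * d - (- c) * c
    norm-via-c = solve (c ∷ d ∷ [])

  NontrivialStab-ρ-1⇒B∈Γ : NontrivialStab Γ ρ-1 → member Γ B
  NontrivialStab-ρ-1⇒B∈Γ (mat a b c d , γ∈Γ , fix , γ≢I , γ≢-I) with fixes-ρ-1⇒ a b c d fix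
  ... | refl , refl = stab-ρ-1-element⇒B∈Γ
    (x²+xy+y²≡1⇒UnitOrZero (- d) c (trans norm-via-d det≡1))
    (x²+xy+y²≡1⇒UnitOrZero (- c) d (trans norm-via-c det≡1))
    det≡1 γ∈Γ γ≢I γ≢-I
    where
    det≡1 : (d - c) * d - (- c) * c ≡ + 1
    det≡1 = ⊆SL₂ Γ γ∈Γ
    norm-via-d : (- d) * (- d) + (- d) * c + c * c ≡ (d - c) * d - (- c) * c
    norm-via-d = solve (c ∷ d ∷ [])
    norm-via-c : (- c) * (- c) + (- c) * d + d * d ≡ (d - c) * d - (- c) * c
    norm-via-c = solve (c ∷ d ∷ [])

mainTheorem2 : (Γ : Subgroup) → IndexAtLeast3 Γ →
    ¬ (NontrivialStab Γ ρ × NontrivialStab Γ ρ-1)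
mainTheorem2 Γ index≥3 (stab-ρ , stab-ρ-1) =
  Γ∪R⁻¹Γ.covering⇒¬IndexAtLeast3 Γ S refl
    (A,B∈Γ⇒covered-by-Γ∪S⁻¹Γ Γ (NontrivialStab-ρ⇒A∈Γ Γ stab-ρ) (NontrivialStab-ρ-1⇒B∈Γ Γ stab-ρ-1))
    index≥3
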